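{- Let $q=p^e$ with $p$ prime, $t\ge 1$, $n\ge 2$, $d\ge 1$, and let $\boldsymbol{\sigma}=(\sigma_0,\ldots,\sigma_{d-1})$ with each $\sigma_i\in\mathrm{Gal}(\mathbb{F}_{q^t}|\mathbb{F}_q)$, $\sigma_i:x\mapsto x^{q^{h_i}}$, $0\le h_i<t$, such that $|\boldsymbol{\sigma}|:=\sum_{i=0}^{d-1}q^{h_i}<q^t$. Let $\nu_{d,\boldsymbol{\sigma}}:\mathrm{PG}(n-1,q^t)\to \mathrm{PG}\big((\mathbb{F}_{q^t}^n)^{\otimes d}\big)$, $\langle v\rangle\mapsto\langle v^{\sigma_0}\otimes v^{\sigma_1}\otimes\cdots\otimes v^{\sigma_{d-1}}\rangle$. Let $\Pi_0,\Pi_1,\ldots,\Pi_{d-1}$ be proper subspaces of $\mathrm{PG}(n-1,q^t)$ and let $P$ be a point of $\mathrm{PG}(n-1,q^t)$ not contained in any $\Pi_i$. Then $\nu_{d,\boldsymbol{\sigma}}(P)$ is not contained in the projective subspace spanned by $\nu_{d,\boldsymbol{\sigma}}(\Pi_0)\cup\nu_{d,\boldsymbol{\sigma}}(\Pi_1)\cup\cdots\cup\nu_{d,\boldsymbol{\sigma}}(\Pi_{d-1})$.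
   Context: For a vector $v=(x_0,\ldots,x_{n-1})\in\mathbb{F}_{q^t}^n$ and a field automorphism $\sigma$, $v^\sigma=(x_0^\sigma,\ldots,x_{n-1}^\sigma)$. $\mathrm{PG}(n-1,q^t)$ is the projective space of $\mathbb{F}_{q^t}^n$; $\nu_{d,\boldsymbol{\sigma}}(\Pi)$ denotes the set of images of the points of $\Pi$. -}

module Defs where

open import Level using (0ℓ)
open import Data.Nat as ℕ using (ℕ; zero; suc)
open import Data.Fin using (Fin)
open import Data.Product using (Σ; ∃; _×_; _,_)
open import Relation.Nullary using (¬_)
open import Relation.Binary.PropositionalEquality using (_≡_)
open import Algebra.Bundles using (CommutativeRing; Semiring)
import Algebra.Definitions.RawSemiring as RawSemiringDefs

record IsFiniteFieldOfOrder (F : CommutativeRing 0ℓ 0ℓ) (N : ℕ) : Set where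
  open CommutativeRing F
  field
    1≉0      : ¬ (1# ≈ 0#)
    inverse  : ∀ x → ¬ (x ≈ 0#) → ∃ λ y → (x * y) ≈ 1#
    enum     : Fin N → Carrier
    enum-inj : ∀ i j → enum i ≈ enum j → i ≡ j
    enum-sur : ∀ x → ∃ λ i → enum i ≈ x

module Geometry (F : CommutativeRing 0ℓ 0ℓ) where
  open CommutativeRing F
  open RawSemiringDefs (Semiring.rawSemiring semiring) using (_^_)

  Vec : ℕ → Set
  Vec n = Fin n → Carrier

  Σ[_] : ∀ m → (Fin m → Carrier) → Carrier
  Σ[ zero  ] f = 0#
  Σ[ suc m ] f = f Fin.zero + Σ[ m ] (λ k → f (Fin.suc k))
    where import Data.Fin as Fin

  Π[_] : ∀ m → (Fin m → Carrier) → Carrier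
  Π[ zero  ] f = 1#
  Π[ suc m ] f = f Fin.zero * Π[ m ] (λ k → f (Fin.suc k))
    where import Data.Fin as Fin

  _≋_ : ∀ {n} → Vec n → Vec n → Set
  u ≋ v = ∀ j → u j ≈ v j

  0v : ∀ {n} → Vec n
  0v _ = 0#

  -- a (vector) subspace of F^n, given by its membership predicate;
  -- its nonzero vectors are the points of the projective subspace.
  record IsSubspace {n : ℕ} (W : Vec n → Set) : Set where
    field
      resp  : ∀ {u v} → u ≋ v → W u → W v
      zero∈ : W 0v
      +∈    : ∀ {u v} → W u → W v → W (λ j → u j + v j)
      ·∈    : ∀ c {u} → W u → W (λ j → c * u j)

  IsProper : ∀ {n} → (Vec n → Set) → Set
  IsProper {n} W = ∃ λ (x : Vec n) → ¬ W x

  frob : ℕ → ℕ → Carrier → Carrier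
  frob q h x = x ^ (q ℕ.^ h)

  -- v^{σ_0} ⊗ ... ⊗ v^{σ_{d-1}}, with σ_i : x ↦ x^(q^(h i)); a tensor in
  -- (F^n)^{⊗d} is given by its coordinates indexed by J : Fin d → Fin n.
  ν : ∀ {n d} (q : ℕ) (h : Fin d → ℕ) → Vec n → ((Fin d → Fin n) → Carrier)
  ν {n} {d} q h v J = Π[ d ] (λ i → frob q (h i) (v (J i)))

  InSpanOfImages : ∀ {n d} (q : ℕ) (h : Fin d → ℕ) (W : Fin d → Vec n → Set)
                   → ((Fin d → Fin n) → Carrier) → Set
  InSpanOfImages {n} {d} q h W T =
    ∃ λ (m : ℕ) → ∃ λ (c : Fin m → Carrier) → ∃ λ (idx : Fin m → Fin d) →
    ∃ λ (w : Fin m → Vec n) →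
      (∀ k → W (idx k) (w k)) ×
      (∀ J → T J ≈ Σ[ m ] (λ k → c k * ν q h (w k) J))

sumPow : ∀ {d} → ℕ → (Fin d → ℕ) → ℕ
sumPow {zero}  q h = 0
sumPow {suc d} q h = q ℕ.^ h Fin.zero ℕ.+ sumPow q (λ i → h (Fin.suc i))
  where import Data.Fin as Fin

-- Each W i lies in the kernel of a linear form aᵢ with aᵢ · v ≠ 0 (constructively only up
-- to double negation). A field of order q ^ t has characteristic p, since translation by 1
-- permutes its elements, so by the freshman's dream each σᵢ = frob q (h i) is an injective
-- ring endomorphism. Pairing a tensor T with σ₀ a₀ ⊗ ⋯ ⊗ σ_{d-1} a_{d-1} is linear in T and
-- sends ν x to Π σᵢ (aᵢ · x); this vanishes on ν w for w in any W i, hence on their span,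
-- but not at ν v.
module Submission where

open import Level using (0ℓ)
open import Data.Nat as ℕ using (ℕ; zero; suc; _∸_; _!; _≤_; _<_; z≤n; s≤s)
open import Data.Nat.Properties using (_!*_!≢0; <⇒≤; <⇒≱; m≤n⇒m≤1+n; ∸-monoʳ-<; n∸n≡0; ^-*-assoc)
open import Data.Nat.Divisibility using (_∣_; divides; ∣⇒≤; ∣1⇒≡1; m∣m*n)
open import Data.Nat.DivMod using (m/n*n≡m)
open import Data.Nat.Primality using (Prime; euclidsLemma; ¬prime[0]; ¬prime[1])
open import Data.Nat.Combinatorics using (_C_; nCn≡1; k![n∸k]!∣n!)
open import Data.Nat.Combinatorics.Specification using (nCk≡n!/k![n-k]!)
open import Data.Fin as Fin using (Fin; toℕ)
import Data.Fin.Properties as Fin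
open import Data.Fin.Properties using (sequence)
open import Data.Fin.Permutation using (permutation)
open import Data.Vec.Functional using ([]; _∷_; head; tail)
open import Data.Empty using (⊥)
open import Data.Product using (∃; _×_; _,_; proj₁; proj₂)
open import Data.Sum using ([_,_]′)
open import Function using (id; _∘_; case_of_)
open import Effect.Monad using (RawMonad)
open import Relation.Nullary using (¬_; contradiction; yes; no)
open import Relation.Nullary.Negation using (¬¬-Monad)
import Relation.Nullary.Decidable as Dec
open import Relation.Nullary.Decidable using (decidable-stable; ¬¬-excluded-middle)
open import Relation.Binary.Definitions using (Decidable)
open import Relation.Binary.PropositionalEquality as ≡ using (_≡_)
open import Algebra.Bundles using (CommutativeSemiring; CommutativeRing; Semiring)
open import Algebra.Morphism.Structures using (module NearSemiringMorphisms)
open import Defs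

p∣n!⇒p≤n : ∀ {p} → Prime p → ∀ n → p ∣ n ! → p ≤ n
p∣n!⇒p≤n p-prime zero p∣1 = contradiction (≡.subst Prime (∣1⇒≡1 p∣1) p-prime) ¬prime[1]
p∣n!⇒p≤n p-prime (suc n) p∣[1+n]! =
  [ ∣⇒≤ , (λ p∣n! → m≤n⇒m≤1+n (p∣n!⇒p≤n p-prime n p∣n!)) ]′ (euclidsLemma (suc n) (n !) p-prime p∣[1+n]!)

-- p divides p! = (p C k) · k! · (p ∸ k)! but, being prime and larger than k and p ∸ k,
-- neither k! nor (p ∸ k)!.
p∣pCk : ∀ {p k} → Prime p → 0 < k → k < p → p ∣ p C k
p∣pCk {suc r} {k} p-prime 0<k k<p =
  [ id , (λ p∣k![p∸k]! → contradiction p∣k![p∸k]! p∤k![p∸k]!) ]′ (euclidsLemma _ _ p-prime p∣pCk*k![p∸k]!)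
  where
  k≤p = <⇒≤ k<p
  instance _ = k !* (suc r ∸ k) !≢0
  pCk*k![p∸k]!≡p! : (suc r C k) ℕ.* (k ! ℕ.* (suc r ∸ k) !) ≡ suc r !
  pCk*k![p∸k]!≡p! = ≡.trans (≡.cong (ℕ._* (k ! ℕ.* (suc r ∸ k) !)) (nCk≡n!/k![n-k]! k≤p))
                            (m/n*n≡m (k![n∸k]!∣n! k≤p))
  p∣pCk*k![p∸k]! : suc r ∣ (suc r C k) ℕ.* (k ! ℕ.* (suc r ∸ k) !)
  p∣pCk*k![p∸k]! = ≡.subst (suc r ∣_) (≡.sym pCk*k![p∸k]!≡p!) (m∣m*n (r !))
  p∤k![p∸k]! : ¬ suc r ∣ k ! ℕ.* (suc r ∸ k) !
  p∤k![p∸k]! p∣ = [ (λ p∣k! → <⇒≱ k<p (p∣n!⇒p≤n p-prime k p∣k!))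
                  , (λ p∣[p∸k]! → <⇒≱ (∸-monoʳ-< 0<k k≤p) (p∣n!⇒p≤n p-prime _ p∣[p∸k]!)) ]′
                  (euclidsLemma _ _ p-prime p∣)

module FreshmansDream {c ℓ} (R : CommutativeSemiring c ℓ) where
  open CommutativeSemiring R
  open import Algebra.Properties.Semiring.Mult semiring
    renaming (_×_ to _ℕ×_) using (×-congʳ; ×-assocˡ; ×-assoc-*)
  open import Algebra.Properties.Semiring.Exp semiring using (_^_; ^-congˡ; ^-assocʳ)
  open import Algebra.Properties.Semiring.Sum semiring using (sum; sum-cong-≋; sum-init-last; sum-replicate-zero)
  open import Algebra.Properties.CommutativeSemiring.Binomial R using (theorem)
  open import Relation.Binary.Reasoning.Setoid setoid

  ×-zeroʳ : ∀ m → m ℕ× 0# ≈ 0#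
  ×-zeroʳ zero    = refl
  ×-zeroʳ (suc m) = trans (+-identityˡ _) (×-zeroʳ m)

  module _ {p} (p-prime : Prime p) (char[p] : p ℕ× 1# ≈ 0#) where

    p∣m⇒m×x≈0 : ∀ {m} x → p ∣ m → m ℕ× x ≈ 0#
    p∣m⇒m×x≈0 {m} x (divides k ≡.refl) = begin
      (k ℕ.* p) ℕ× x          ≈⟨ ×-assocˡ x k p ⟨
      k ℕ× (p ℕ× x)           ≈⟨ ×-congʳ k (×-congʳ p (*-identityˡ x)) ⟨
      k ℕ× (p ℕ× (1# * x))    ≈⟨ ×-congʳ k (×-assoc-* p 1# x) ⟨
      k ℕ× ((p ℕ× 1#) * x)    ≈⟨ ×-congʳ k (trans (*-congʳ char[p]) (zeroˡ x)) ⟩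
      k ℕ× 0#                 ≈⟨ ×-zeroʳ k ⟩
      0#                      ∎

    -- Only the two outer terms of the binomial expansion of (x + y) ^ p survive.
    ^p-homo-+ : ∀ x y → (x + y) ^ p ≈ x ^ p + y ^ p
    ^p-homo-+ = expand p ≡.refl
      where
      expand : ∀ p′ → p′ ≡ p → ∀ x y → (x + y) ^ p′ ≈ x ^ p′ + y ^ p′
      expand zero          ≡.refl = contradiction p-prime ¬prime[0]
      expand (suc zero)    ≡.refl = contradiction p-prime ¬prime[1]
      expand (suc (suc r)) ≡.refl x y = begin
        (x + y) ^ p
          ≈⟨ theorem p x y ⟩
        term 0 + sum {suc (suc r)} (λ i → term (suc (toℕ i)))
          ≈⟨ +-congˡ (sum-init-last {suc r} (λ i → term (suc (toℕ i)))) ⟩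
        term 0 + (sum {suc r} (λ i → term (suc (toℕ (Fin.inject₁ i)))) + term (suc (toℕ (Fin.fromℕ (suc r)))))
          ≈⟨ +-cong first (+-cong middle last) ⟩
        y ^ p + (0# + x ^ p)
          ≈⟨ +-comm _ _ ⟩
        (0# + x ^ p) + y ^ p
          ≈⟨ +-congʳ (+-identityˡ _) ⟩
        x ^ p + y ^ p ∎
        where
        term : ℕ → Carrier
        term k = (p C k) ℕ× (x ^ k * y ^ (p ∸ k))
        first : term 0 ≈ y ^ p
        first = trans (+-identityʳ _) (*-identityˡ _)
        last : term (suc (toℕ (Fin.fromℕ (suc r)))) ≈ x ^ p
        last = begin
          term (suc (toℕ (Fin.fromℕ (suc r)))) ≡⟨ ≡.cong (λ k → term (suc k)) (Fin.toℕ-fromℕ (suc r)) ⟩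
          (p C p) ℕ× (x ^ p * y ^ (p ∸ p))     ≡⟨ ≡.cong₂ (λ c k → c ℕ× (x ^ p * y ^ k)) (nCn≡1 p) (n∸n≡0 p) ⟩
          1 ℕ× (x ^ p * 1#)                    ≈⟨ +-identityʳ _ ⟩
          x ^ p * 1#                           ≈⟨ *-identityʳ _ ⟩
          x ^ p                                ∎
        inner : ∀ k → 0 < k → k < p → term k ≈ 0#
        inner k 0<k k<p = p∣m⇒m×x≈0 (x ^ k * y ^ (p ∸ k)) (p∣pCk p-prime 0<k k<p)
        middle : sum {suc r} (λ i → term (suc (toℕ (Fin.inject₁ i)))) ≈ 0#
        middle = trans (sum-cong-≋ {suc r} λ i →
                          trans (reflexive (≡.cong (λ k → term (suc k)) (Fin.toℕ-inject₁ i)))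
                                (inner (suc (toℕ i)) (s≤s z≤n) (s≤s (Fin.toℕ<n i))))
                       (sum-replicate-zero (suc r))

    ^p^k-homo-+ : ∀ k x y → (x + y) ^ (p ℕ.^ k) ≈ x ^ (p ℕ.^ k) + y ^ (p ℕ.^ k)
    ^p^k-homo-+ zero    x y = distribʳ 1# x y
    ^p^k-homo-+ (suc k) x y = begin
      (x + y) ^ (p ℕ.* p ℕ.^ k)                  ≈⟨ ^-assocʳ (x + y) p (p ℕ.^ k) ⟨
      ((x + y) ^ p) ^ (p ℕ.^ k)                  ≈⟨ ^-congˡ (p ℕ.^ k) (^p-homo-+ x y) ⟩
      (x ^ p + y ^ p) ^ (p ℕ.^ k)                ≈⟨ ^p^k-homo-+ k (x ^ p) (y ^ p) ⟩
      (x ^ p) ^ (p ℕ.^ k) + (y ^ p) ^ (p ℕ.^ k)  ≈⟨ +-cong (^-assocʳ x p (p ℕ.^ k)) (^-assocʳ y p (p ℕ.^ k)) ⟩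
      x ^ (p ℕ.* p ℕ.^ k) + y ^ (p ℕ.* p ℕ.^ k)  ∎

module _ (F : CommutativeRing 0ℓ 0ℓ) where
  open CommutativeRing F
  open Geometry F
  open NearSemiringMorphisms (Semiring.rawNearSemiring semiring) (Semiring.rawNearSemiring semiring)
    using (IsNearSemiringHomomorphism; IsNearSemiringMonomorphism)
  open import Relation.Binary.Reasoning.Setoid setoid
  open import Algebra.Properties.Semiring.Exp semiring using (_^_; ^-congˡ)
  open import Algebra.Properties.Ring ring using (-‿distribˡ-*)
  open import Algebra.Properties.Semiring.Mult semiring renaming (_×_ to _ℕ×_) using (×1-homo-*)
  open import Algebra.Properties.CommutativeSemiring.Exp commutativeSemiring using (^-distrib-*)
  open import Algebra.Properties.CommutativeMonoid.Sum +-commutativeMonoid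
    using (sum; sum-cong-≋; ∑-permute; ∑-distrib-+; sum-replicate)
  open import Algebra.Properties.Group +-group using (loop; x∙y⁻¹≈ε⇒x≈y; //-rightDividesˡ)
  open import Algebra.Properties.Loop loop using (identityˡ-unique; identityʳ-unique)
  open FreshmansDream commutativeSemiring using (^p^k-homo-+)
  open import Algebra.Properties.CommutativeSemigroup +-commutativeSemigroup
    using () renaming (interchange to +-interchange)
  open import Algebra.Properties.CommutativeSemigroup *-commutativeSemigroup
    using (x∙yz≈y∙xz) renaming (interchange to *-interchange)

  Σ-cong : ∀ m {f g : Fin m → Carrier} → (∀ k → f k ≈ g k) → Σ[ m ] f ≈ Σ[ m ] g
  Σ-cong zero    f≈g = refl
  Σ-cong (suc m) f≈g = +-cong (f≈g Fin.zero) (Σ-cong m (f≈g ∘ Fin.suc))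

  Σ-zero : ∀ m {f : Fin m → Carrier} → (∀ k → f k ≈ 0#) → Σ[ m ] f ≈ 0#
  Σ-zero zero    f≈0 = refl
  Σ-zero (suc m) f≈0 = trans (+-cong (f≈0 Fin.zero) (Σ-zero m (f≈0 ∘ Fin.suc))) (+-identityˡ 0#)

  Σ-distrib-+ : ∀ m (f g : Fin m → Carrier) → Σ[ m ] (λ k → f k + g k) ≈ Σ[ m ] f + Σ[ m ] g
  Σ-distrib-+ zero    f g = sym (+-identityˡ 0#)
  Σ-distrib-+ (suc m) f g = trans (+-congˡ (Σ-distrib-+ m _ _)) (+-interchange _ _ _ _)

  *-distribˡ-Σ : ∀ m c (f : Fin m → Carrier) → c * Σ[ m ] f ≈ Σ[ m ] (λ k → c * f k)
  *-distribˡ-Σ zero    c f = zeroʳ c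
  *-distribˡ-Σ (suc m) c f = trans (distribˡ _ _ _) (+-congˡ (*-distribˡ-Σ m c _))

  Σ-comm : ∀ m n (f : Fin m → Fin n → Carrier) →
           Σ[ m ] (λ k → Σ[ n ] (f k)) ≈ Σ[ n ] (λ j → Σ[ m ] (λ k → f k j))
  Σ-comm zero    n f = sym (Σ-zero n (λ _ → refl))
  Σ-comm (suc m) n f = trans (+-congˡ (Σ-comm m n _)) (sym (Σ-distrib-+ n _ _))

  Π-cong : ∀ m {f g : Fin m → Carrier} → (∀ k → f k ≈ g k) → Π[ m ] f ≈ Π[ m ] g
  Π-cong zero    f≈g = refl
  Π-cong (suc m) f≈g = *-cong (f≈g Fin.zero) (Π-cong m (f≈g ∘ Fin.suc))

  Π-distrib-* : ∀ m (f g : Fin m → Carrier) → Π[ m ] (λ k → f k * g k) ≈ Π[ m ] f * Π[ m ] g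
  Π-distrib-* zero    f g = sym (*-identityˡ 1#)
  Π-distrib-* (suc m) f g = trans (*-congˡ (Π-distrib-* m _ _)) (*-interchange _ _ _ _)

  Π-zero : ∀ m (f : Fin m → Carrier) i → f i ≈ 0# → Π[ m ] f ≈ 0#
  Π-zero (suc m) f Fin.zero    fi≈0 = trans (*-congʳ fi≈0) (zeroˡ _)
  Π-zero (suc m) f (Fin.suc i) fi≈0 = trans (*-congˡ (Π-zero m _ i fi≈0)) (zeroʳ _)

  Σᴶ[_] : ∀ {n} d → ((Fin d → Fin n) → Carrier) → Carrier
  Σᴶ[ zero  ] f = f []
  Σᴶ[_] {n} (suc d) f = Σ[ n ] (λ j → Σᴶ[ d ] (λ J → f (j ∷ J)))

  Σᴶ-cong : ∀ {n} d {f g : (Fin d → Fin n) → Carrier} → (∀ J → f J ≈ g J) → Σᴶ[ d ] f ≈ Σᴶ[ d ] g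
  Σᴶ-cong zero    f≈g = f≈g []
  Σᴶ-cong {n} (suc d) f≈g = Σ-cong n (λ j → Σᴶ-cong d (λ J → f≈g (j ∷ J)))

  *-distribˡ-Σᴶ : ∀ {n} d c (f : (Fin d → Fin n) → Carrier) → c * Σᴶ[ d ] f ≈ Σᴶ[ d ] (λ J → c * f J)
  *-distribˡ-Σᴶ zero    c f = refl
  *-distribˡ-Σᴶ {n} (suc d) c f = trans (*-distribˡ-Σ n c _) (Σ-cong n (λ j → *-distribˡ-Σᴶ d c _))

  Σᴶ-Σ-comm : ∀ {n} d m (f : Fin m → (Fin d → Fin n) → Carrier) →
              Σᴶ[ d ] (λ J → Σ[ m ] (λ k → f k J)) ≈ Σ[ m ] (λ k → Σᴶ[ d ] (f k))
  Σᴶ-Σ-comm zero    m f = refl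
  Σᴶ-Σ-comm {n} (suc d) m f =
    trans (Σ-cong n (λ j → Σᴶ-Σ-comm d m (λ k J → f k (j ∷ J)))) (sym (Σ-comm m n _))

  Σᴶ-Π : ∀ {n} d (g : Fin d → Fin n → Carrier) →
         Σᴶ[ d ] (λ J → Π[ d ] (λ i → g i (J i))) ≈ Π[ d ] (λ i → Σ[ n ] (g i))
  Σᴶ-Π zero    g = refl
  Σᴶ-Π {n} (suc d) g = begin
    Σ[ n ] (λ j → Σᴶ[ d ] (λ J → g Fin.zero j * Π[ d ] (λ i → g (Fin.suc i) (J i))))
      ≈⟨ Σ-cong n (λ j → *-distribˡ-Σᴶ d _ _) ⟨
    Σ[ n ] (λ j → g Fin.zero j * Σᴶ[ d ] (λ J → Π[ d ] (λ i → g (Fin.suc i) (J i))))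
      ≈⟨ Σ-cong n (λ j → *-congˡ (Σᴶ-Π d (g ∘ Fin.suc))) ⟩
    Σ[ n ] (λ j → g Fin.zero j * rest)
      ≈⟨ Σ-cong n (λ j → *-comm _ _) ⟩
    Σ[ n ] (λ j → rest * g Fin.zero j)
      ≈⟨ *-distribˡ-Σ n rest _ ⟨
    rest * Σ[ n ] (g Fin.zero)
      ≈⟨ *-comm _ _ ⟩
    Σ[ n ] (g Fin.zero) * rest ∎
    where rest = Π[ d ] (λ i → Σ[ n ] (g (Fin.suc i)))

  _·_ : ∀ {n} → Vec n → Vec n → Carrier
  _·_ {n} a x = Σ[ n ] (λ j → a j * x j)

  Tensor : ℕ → ℕ → Set
  Tensor n d = (Fin d → Fin n) → Carrier

  ⨂ : ∀ {n d} → (Fin d → Vec n) → Tensor n d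
  ⨂ {d = d} x J = Π[ d ] (λ i → x i (J i))

  ⟪_,_⟫ : ∀ {n d} → Tensor n d → Tensor n d → Carrier
  ⟪_,_⟫ {d = d} S T = Σᴶ[ d ] (λ J → S J * T J)

  ⟪⨂,⨂⟫ : ∀ {n d} (a x : Fin d → Vec n) → ⟪ ⨂ a , ⨂ x ⟫ ≈ Π[ d ] (λ i → a i · x i)
  ⟪⨂,⨂⟫ {n} {d} a x = begin
    Σᴶ[ d ] (λ J → ⨂ a J * ⨂ x J)                     ≈⟨ Σᴶ-cong d (λ J → Π-distrib-* d _ _) ⟨
    Σᴶ[ d ] (λ J → Π[ d ] (λ i → a i (J i) * x i (J i))) ≈⟨ Σᴶ-Π d (λ i j → a i j * x i j) ⟩
    Π[ d ] (λ i → a i · x i)                              ∎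

  ⟪⟫-linearʳ : ∀ {n d m} S T (c : Fin m → Carrier) (T′ : Fin m → Tensor n d) →
               (∀ J → T J ≈ Σ[ m ] (λ k → c k * T′ k J)) → ⟪ S , T ⟫ ≈ Σ[ m ] (λ k → c k * ⟪ S , T′ k ⟫)
  ⟪⟫-linearʳ {n} {d} {m} S T c T′ T≈ΣcT′ = begin
    Σᴶ[ d ] (λ J → S J * T J)                           ≈⟨ Σᴶ-cong d (λ J → *-congˡ (T≈ΣcT′ J)) ⟩
    Σᴶ[ d ] (λ J → S J * Σ[ m ] (λ k → c k * T′ k J))   ≈⟨ Σᴶ-cong d (λ J → *-distribˡ-Σ m _ _) ⟩
    Σᴶ[ d ] (λ J → Σ[ m ] (λ k → S J * (c k * T′ k J))) ≈⟨ Σᴶ-cong d (λ J → Σ-cong m (λ k → x∙yz≈y∙xz _ _ _)) ⟩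
    Σᴶ[ d ] (λ J → Σ[ m ] (λ k → c k * (S J * T′ k J))) ≈⟨ Σᴶ-Σ-comm d m _ ⟩
    Σ[ m ] (λ k → Σᴶ[ d ] (λ J → c k * (S J * T′ k J))) ≈⟨ Σ-cong m (λ k → *-distribˡ-Σᴶ d (c k) _) ⟨
    Σ[ m ] (λ k → c k * ⟪ S , T′ k ⟫)                   ∎

  ·-linearʳ : ∀ {n} (a x y : Vec n) c → a · (λ j → x j + c * y j) ≈ a · x + c * (a · y)
  ·-linearʳ {n} a x y c = begin
    Σ[ n ] (λ j → a j * (x j + c * y j))
      ≈⟨ Σ-cong n (λ j → trans (distribˡ _ _ _) (+-congˡ (x∙yz≈y∙xz _ _ _))) ⟩
    Σ[ n ] (λ j → a j * x j + c * (a j * y j)) ≈⟨ Σ-distrib-+ n _ _ ⟩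
    a · x + Σ[ n ] (λ j → c * (a j * y j))     ≈⟨ +-congˡ (*-distribˡ-Σ n c _) ⟨
    a · x + c * (a · y)                        ∎

  module _ {σ : Carrier → Carrier} (σ-homo : IsNearSemiringHomomorphism σ) where
    private module σ = IsNearSemiringHomomorphism σ-homo

    σ-Σ : ∀ m (f : Fin m → Carrier) → σ (Σ[ m ] f) ≈ Σ[ m ] (σ ∘ f)
    σ-Σ zero    f = σ.0#-homo
    σ-Σ (suc m) f = trans (σ.+-homo _ _) (+-congˡ (σ-Σ m _))

    σ-· : ∀ {n} (a x : Vec n) → σ (a · x) ≈ (σ ∘ a) · (σ ∘ x)
    σ-· {n} a x = trans (σ-Σ n _) (Σ-cong n (λ j → σ.*-homo (a j) (x j)))

  Separates : ∀ {n} → (Vec n → Set) → Vec n → Vec n → Set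
  Separates W u a = (∀ {x} → W x → a · x ≈ 0#) × ¬ a · u ≈ 0#

  slice : ∀ {n} → (Vec (suc n) → Set) → Vec n → Set
  slice W y = W (0# ∷ y)

  ≋-sym : ∀ {n} {x y : Vec n} → x ≋ y → y ≋ x
  ≋-sym x≋y j = sym (x≋y j)

  ≋-0∷tail : ∀ {n} {x : Vec (suc n)} → head x ≈ 0# → x ≋ (0# ∷ tail x)
  ≋-0∷tail x₀≈0 Fin.zero    = x₀≈0
  ≋-0∷tail x₀≈0 (Fin.suc j) = refl

  slice-isSubspace : ∀ {n} {W : Vec (suc n) → Set} → IsSubspace W → IsSubspace (slice W)
  slice-isSubspace W-sub = record
    { resp  = λ u≋v → resp (λ { Fin.zero → refl ; (Fin.suc j) → u≋v j })
    ; zero∈ = resp (≋-0∷tail refl) zero∈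
    ; +∈    = λ u∈ v∈ → resp (≋-0∷tail (+-identityˡ 0#)) (+∈ u∈ v∈)
    ; ·∈    = λ c u∈ → resp (≋-0∷tail (zeroʳ c)) (·∈ c u∈)
    }
    where open IsSubspace W-sub

  ·-head≈0 : ∀ {n} (a x : Vec (suc n)) → head x ≈ 0# → a · x ≈ tail a · tail x
  ·-head≈0 a x x₀≈0 = trans (+-congʳ (trans (*-congˡ x₀≈0) (zeroʳ _))) (+-identityˡ _)

  separates-lift : ∀ {n} {W : Vec (suc n) → Set} → IsSubspace W → ∀ {u} a (P : Vec (suc n) → Vec (suc n)) →
                   (∀ {x} → W x → W (P x)) → (∀ x → head (P x) ≈ 0#) → (∀ x → a · P x ≈ a · x) →
                   Separates (slice W) (tail (P u)) (tail a) → Separates W u a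
  separates-lift W-sub {u} a P P∈W P₀≈0 a·P≈a· (vanishes , a·Pu≉0) =
    (λ {x} x∈W → trans (sym (a·P≈a· x)) (trans (a·P≈tail x) (vanishes (resp (≋-0∷tail (P₀≈0 x)) (P∈W x∈W))))) ,
    (λ a·u≈0 → a·Pu≉0 (trans (sym (a·P≈tail u)) (trans (a·P≈a· u) a·u≈0)))
    where
    open IsSubspace W-sub
    a·P≈tail : ∀ x → a · P x ≈ tail a · tail (P x)
    a·P≈tail x = ·-head≈0 a (P x) (P₀≈0 x)

  separates-lift-trivial : ∀ {n} {W : Vec (suc n) → Set} → IsSubspace W → (∀ {x} → W x → head x ≈ 0#) →
                           ∀ {u} a → Separates (slice W) (tail u) a → Separates W u (0# ∷ a)
  separates-lift-trivial W-sub W₀≈0 {u} a =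
    separates-lift W-sub {u} (0# ∷ a) (λ x → 0# ∷ tail x)
      (λ x∈W → resp (≋-0∷tail (W₀≈0 x∈W)) x∈W) (λ _ → refl)
      (λ x → +-congʳ (trans (zeroˡ 0#) (sym (zeroˡ (head x)))))
    where open IsSubspace W-sub

  first-coordinate-separates : ∀ {n} {W : Vec (suc n) → Set} → (∀ {x} → W x → head x ≈ 0#) →
                               ∀ {u} → ¬ head u ≈ 0# → Separates W u (1# ∷ λ _ → 0#)
  first-coordinate-separates {n} W₀≈0 {u} u₀≉0 =
    (λ {x} x∈W → trans (e₀·x≈x₀ x) (W₀≈0 x∈W)) , (λ e₀·u≈0 → u₀≉0 (trans (sym (e₀·x≈x₀ u)) e₀·u≈0))
    where
    e₀·x≈x₀ : ∀ (x : Vec (suc n)) → (1# ∷ λ _ → 0#) · x ≈ head x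
    e₀·x≈x₀ x = trans (+-cong (*-identityˡ _) (Σ-zero n (λ j → zeroˡ _))) (+-identityʳ _)

  -- Gaussian elimination against a vector w ∈ W with head w invertible: subtracting
  -- (head x * w⁻¹) · w from x clears the first coordinate without leaving W.
  module Pivot {n} {W : Vec (suc n) → Set} (W-sub : IsSubspace W) {w} (w∈W : W w)
               {w⁻¹} (w₀w⁻¹≈1 : head w * w⁻¹ ≈ 1#) where
    open IsSubspace W-sub

    clear : ∀ x₀ → x₀ + (- (x₀ * w⁻¹)) * head w ≈ 0#
    clear x₀ = begin
      x₀ + (- (x₀ * w⁻¹)) * head w   ≈⟨ +-congˡ (-‿distribˡ-* _ _) ⟨
      x₀ + - ((x₀ * w⁻¹) * head w)   ≈⟨ +-congˡ (-‿cong (*-assoc _ _ _)) ⟩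
      x₀ + - (x₀ * (w⁻¹ * head w))   ≈⟨ +-congˡ (-‿cong (*-congˡ (trans (*-comm _ _) w₀w⁻¹≈1))) ⟩
      x₀ + - (x₀ * 1#)               ≈⟨ +-congˡ (-‿cong (*-identityʳ x₀)) ⟩
      x₀ + - x₀                      ≈⟨ -‿inverseʳ x₀ ⟩
      0#                             ∎

    eliminate : Vec (suc n) → Vec (suc n)
    eliminate x j = x j + (- (head x * w⁻¹)) * w j

    eliminate∈W : ∀ {x} → W x → W (eliminate x)
    eliminate∈W x∈W = +∈ x∈W (·∈ _ w∈W)

    head-eliminate : ∀ x → head (eliminate x) ≈ 0#
    head-eliminate x = clear (head x)

    eliminate∉slice : ∀ {u} → ¬ W u → ¬ slice W (tail (eliminate u))
    eliminate∉slice {u} u∉W ∈slice = u∉W (resp restore (+∈ eliminate-u∈W (·∈ c w∈W)))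
      where
      c = head u * w⁻¹
      eliminate-u∈W : W (eliminate u)
      eliminate-u∈W = resp (≋-sym (≋-0∷tail (head-eliminate u))) ∈slice
      restore : (λ j → eliminate u j + c * w j) ≋ u
      restore j = begin
        (u j + (- c) * w j) + c * w j  ≈⟨ +-assoc _ _ _ ⟩
        u j + ((- c) * w j + c * w j)  ≈⟨ +-congˡ (distribʳ (w j) (- c) c) ⟨
        u j + (- c + c) * w j          ≈⟨ +-congˡ (trans (*-congʳ (-‿inverseˡ c)) (zeroˡ (w j))) ⟩
        u j + 0#                       ≈⟨ +-identityʳ (u j) ⟩
        u j                            ∎

    lift : Vec n → Vec (suc n)
    lift a = (- ((a · tail w) * w⁻¹)) ∷ a

    separates-lift-pivot : ∀ {u} a → Separates (slice W) (tail (eliminate u)) a → Separates W u (lift a)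
    separates-lift-pivot {u} a = separates-lift W-sub {u} â eliminate eliminate∈W head-eliminate â·eliminate≈â·
      where
      â = lift a
      â·w≈0 : â · w ≈ 0#
      â·w≈0 = trans (+-comm _ _) (clear (a · tail w))
      â·eliminate≈â· : ∀ x → â · eliminate x ≈ â · x
      â·eliminate≈â· x = begin
        â · eliminate x                       ≈⟨ ·-linearʳ â x w _ ⟩
        â · x + (- (head x * w⁻¹)) * (â · w)  ≈⟨ +-congˡ (trans (*-congˡ â·w≈0) (zeroʳ _)) ⟩
        â · x + 0#                            ≈⟨ +-identityʳ _ ⟩
        â · x                                 ∎

  ℕ×1-homo-^ : ∀ m k → (m ℕ.^ k) ℕ× 1# ≈ (m ℕ× 1#) ^ k
  ℕ×1-homo-^ m zero    = +-identityʳ 1#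
  ℕ×1-homo-^ m (suc k) = trans (×1-homo-* m (m ℕ.^ k)) (*-congˡ (ℕ×1-homo-^ m k))

  -- Translation by 1# permutes the N elements, so their sum S satisfies S ≈ S + N · 1#.
  order×1≈0 : ∀ {N} (enum : Fin N → Carrier) → (∀ i j → enum i ≈ enum j → i ≡ j) →
              (∀ x → ∃ λ i → enum i ≈ x) → N ℕ× 1# ≈ 0#
  order×1≈0 {N} enum enum-inj enum-sur = identityʳ-unique (sum enum) (N ℕ× 1#) (sym (begin
    sum enum                          ≈⟨ ∑-permute enum translation ⟩
    sum (enum ∘ translate 1#)         ≈⟨ sum-cong-≋ {N} (λ i → proj₂ (enum-sur _)) ⟩
    sum (λ i → enum i + 1#)           ≈⟨ ∑-distrib-+ enum (λ _ → 1#) ⟩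
    sum enum + sum {N} (λ _ → 1#)     ≈⟨ +-congˡ (sum-replicate N) ⟩
    sum enum + N ℕ× 1#                ∎))
    where
    translate : Carrier → Fin N → Fin N
    translate c i = proj₁ (enum-sur (enum i + c))
    translate-inverse : ∀ {c c′} → c + c′ ≈ 0# → ∀ i → translate c′ (translate c i) ≡ i
    translate-inverse {c} {c′} c+c′≈0 i = enum-inj _ _ (begin
      enum (translate c′ (translate c i))  ≈⟨ proj₂ (enum-sur _) ⟩
      enum (translate c i) + c′            ≈⟨ +-congʳ (proj₂ (enum-sur _)) ⟩
      (enum i + c) + c′                    ≈⟨ +-assoc _ _ _ ⟩
      enum i + (c + c′)                    ≈⟨ +-congˡ c+c′≈0 ⟩
      enum i + 0#                          ≈⟨ +-identityʳ _ ⟩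
      enum i                               ∎)
    translation = permutation (translate 1#) (translate (- 1#))
                    (translate-inverse (-‿inverseˡ 1#)) (translate-inverse (-‿inverseʳ 1#))

  module DiscreteField (1≉0 : ¬ 1# ≈ 0#) (inverse : ∀ x → ¬ x ≈ 0# → ∃ λ y → x * y ≈ 1#)
                       (_≟_ : Decidable _≈_) where

    *-nonzero : ∀ {x y} → ¬ x ≈ 0# → ¬ y ≈ 0# → ¬ x * y ≈ 0#
    *-nonzero {x} {y} x≉0 y≉0 xy≈0 with inverse x x≉0
    ... | x⁻¹ , xx⁻¹≈1 = y≉0 (begin
      y              ≈⟨ *-identityˡ y ⟨
      1# * y         ≈⟨ *-congʳ (trans (sym xx⁻¹≈1) (*-comm x x⁻¹)) ⟩
      (x⁻¹ * x) * y  ≈⟨ *-assoc _ _ _ ⟩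
      x⁻¹ * (x * y)  ≈⟨ *-congˡ xy≈0 ⟩
      x⁻¹ * 0#       ≈⟨ zeroʳ x⁻¹ ⟩
      0#             ∎)

    Π-nonzero : ∀ m (f : Fin m → Carrier) → (∀ i → ¬ f i ≈ 0#) → ¬ Π[ m ] f ≈ 0#
    Π-nonzero zero    f f≉0 = 1≉0
    Π-nonzero (suc m) f f≉0 = *-nonzero (f≉0 Fin.zero) (Π-nonzero m _ (f≉0 ∘ Fin.suc))

    ^-nonzero : ∀ k {x} → ¬ x ≈ 0# → ¬ x ^ k ≈ 0#
    ^-nonzero zero    x≉0 = 1≉0
    ^-nonzero (suc k) x≉0 = *-nonzero x≉0 (^-nonzero k x≉0)

    x^k≈0⇒x≈0 : ∀ k {x} → x ^ k ≈ 0# → x ≈ 0#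
    x^k≈0⇒x≈0 k {x} x^k≈0 = decidable-stable (x ≟ 0#) (λ x≉0 → ^-nonzero k x≉0 x^k≈0)

    -- Subspaces are arbitrary predicates, so whether W has a vector with nonzero first
    -- coordinate is not decidable: the separating form exists only up to double negation.
    separation : ∀ {n} {W : Vec n → Set} → IsSubspace W → ∀ {u} → ¬ W u → ¬ ¬ ∃ (Separates W u)
    separation {zero} W-sub u∉W _ = u∉W (resp (λ ()) zero∈)
      where open IsSubspace W-sub
    separation {suc n} {W} W-sub {u} u∉W ∄separation =
      ¬¬-excluded-middle {A = ∃ λ w → W w × ¬ head w ≈ 0#} λ where
      (yes (w , w∈W , w₀≉0)) →
        let w⁻¹ , w₀w⁻¹≈1 = inverse (head w) w₀≉0
            open Pivot W-sub w∈W w₀w⁻¹≈1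
        in  separation (slice-isSubspace W-sub) (eliminate∉slice u∉W)
              (λ (a , a-sep) → ∄separation (lift a , separates-lift-pivot {u} a a-sep))
      (no ∄pivot) →
        let W₀≈0 : ∀ {x} → W x → head x ≈ 0#
            W₀≈0 {x} x∈W = decidable-stable (head x ≟ 0#) (λ x₀≉0 → ∄pivot (x , x∈W , x₀≉0))
        in  case head u ≟ 0# of λ where
              (no u₀≉0) → ∄separation (1# ∷ (λ _ → 0#) , first-coordinate-separates W₀≈0 {u} u₀≉0)
              (yes u₀≈0) → separation (slice-isSubspace W-sub)
                             (u∉W ∘ IsSubspace.resp W-sub (≋-sym (≋-0∷tail u₀≈0)))
                             (λ (a , a-sep) →
                               ∄separation (0# ∷ a , separates-lift-trivial W-sub W₀≈0 {u} a a-sep))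

    module _ {p} (p-prime : Prime p) (char[p] : p ℕ× 1# ≈ 0#) where

      ^p^k-isMonomorphism : ∀ k → IsNearSemiringMonomorphism (_^ (p ℕ.^ k))
      ^p^k-isMonomorphism k = record
        { isNearSemiringHomomorphism = record
          { +-isMonoidHomomorphism = record
            { isMagmaHomomorphism = record
              { isRelHomomorphism = record { cong = ^-congˡ (p ℕ.^ k) }
              ; homo = σ-+ }
            ; ε-homo = identityʳ-unique (σ 0#) (σ 0#)
                         (trans (sym (σ-+ 0# 0#)) (^-congˡ (p ℕ.^ k) (+-identityʳ 0#))) }
          ; *-homo = λ x y → ^-distrib-* x y (p ℕ.^ k) }
        ; injective = λ {x} {y} σx≈σy → x∙y⁻¹≈ε⇒x≈y x y (x^k≈0⇒x≈0 (p ℕ.^ k)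
            (identityˡ-unique (σ (x - y)) (σ y) (begin
              σ (x - y) + σ y  ≈⟨ σ-+ (x - y) y ⟨
              σ (x - y + y)    ≈⟨ ^-congˡ (p ℕ.^ k) (//-rightDividesˡ y x) ⟩
              σ x              ≈⟨ σx≈σy ⟩
              σ y              ∎)))
        }
        where
        σ = _^ (p ℕ.^ k)
        σ-+ = ^p^k-homo-+ p-prime char[p] k

    ν∉span : ∀ {n d} q (h : Fin d → ℕ) → (∀ i → IsNearSemiringMonomorphism (frob q (h i))) →
             (W : Fin d → Vec n → Set) → (∀ i → IsSubspace (W i)) →
             ∀ v → (∀ i → ¬ W i v) → ¬ InSpanOfImages q h W (ν q h v)
    ν∉span {n} {d} q h σ-mono W W-sub v v∉W (m , c , idx , w , w∈W , ν[v]≈Σ) =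
      sequence (RawMonad.rawApplicative ¬¬-Monad) (λ i → separation (W-sub i) (v∉W i)) refute
      where
      σ : Fin d → Carrier → Carrier
      σ i = frob q (h i)
      module σ i = IsNearSemiringMonomorphism (σ-mono i)

      σ-reflects-0 : ∀ i {x} → σ i x ≈ 0# → x ≈ 0#
      σ-reflects-0 i σx≈0 = σ.injective i (trans σx≈0 (sym (σ.0#-homo i)))

      refute : (∀ i → ∃ (Separates (W i) v)) → ⊥
      refute seps = Π-nonzero d _ (λ i → proj₂ (sep i) ∘ σ-reflects-0 i) (trans (sym (⟪B,ν⟫ v)) ⟪B,νv⟫≈0)
        where
        a : Fin d → Vec n
        a i = proj₁ (seps i)
        sep : ∀ i → Separates (W i) v (a i)
        sep i = proj₂ (seps i)
        B : Tensor n d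
        B = ⨂ (λ i → σ i ∘ a i)
        ⟪B,ν⟫ : ∀ x → ⟪ B , ν q h x ⟫ ≈ Π[ d ] (λ i → σ i (a i · x))
        ⟪B,ν⟫ x = trans (⟪⨂,⨂⟫ (λ i → σ i ∘ a i) (λ i → σ i ∘ x))
                        (Π-cong d (λ i → sym (σ-· (σ.isNearSemiringHomomorphism i) (a i) x)))
        ⟪B,νw⟫≈0 : ∀ k → ⟪ B , ν q h (w k) ⟫ ≈ 0#
        ⟪B,νw⟫≈0 k = trans (⟪B,ν⟫ (w k))
          (Π-zero d _ (idx k) (trans (σ.⟦⟧-cong (idx k) (proj₁ (sep (idx k)) (w∈W k))) (σ.0#-homo (idx k))))
        ⟪B,νv⟫≈0 : ⟪ B , ν q h v ⟫ ≈ 0#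
        ⟪B,νv⟫≈0 = trans (⟪⟫-linearʳ B (ν q h v) c (λ k → ν q h (w k)) ν[v]≈Σ)
                         (Σ-zero m (λ k → trans (*-congˡ (⟪B,νw⟫≈0 k)) (zeroʳ _)))

  module FiniteField {N} (isFF : IsFiniteFieldOfOrder F N) where
    open IsFiniteFieldOfOrder isFF

    _≟_ : Decidable _≈_
    x ≟ y with enum-sur x | enum-sur y
    ... | i , eᵢ≈x | j , eⱼ≈y = Dec.map′ (λ { ≡.refl → trans (sym eᵢ≈x) eⱼ≈y })
                                         (λ x≈y → enum-inj i j (trans eᵢ≈x (trans x≈y (sym eⱼ≈y)))) (i Fin.≟ j)

    open DiscreteField 1≉0 inverse _≟_ public

    char[p] : ∀ {p k} → N ≡ p ℕ.^ k → p ℕ× 1# ≈ 0#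
    char[p] {p} {k} N≡p^k = x^k≈0⇒x≈0 k (begin
      (p ℕ× 1#) ^ k     ≈⟨ ℕ×1-homo-^ p k ⟨
      (p ℕ.^ k) ℕ× 1#   ≡⟨ ≡.cong (_ℕ× 1#) N≡p^k ⟨
      N ℕ× 1#           ≈⟨ order×1≈0 enum enum-inj enum-sur ⟩
      0#                ∎)

    frob-isMonomorphism : ∀ {p e t} → Prime p → N ≡ (p ℕ.^ e) ℕ.^ t →
                          ∀ k → IsNearSemiringMonomorphism (frob (p ℕ.^ e) k)
    frob-isMonomorphism {p} {e} {t} p-prime N≡q^t k =
      ≡.subst (λ m → IsNearSemiringMonomorphism (_^ m)) (≡.sym (^-*-assoc p e k))
        (^p^k-isMonomorphism p-prime (char[p] {p} {e ℕ.* t} (≡.trans N≡q^t (^-*-assoc p e t))) (e ℕ.* k))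

open import Data.Nat using (_^_)

mainTheorem1 : (p e q t n d : ℕ) → Prime p → 1 ≤ e → q ≡ p ^ e → 1 ≤ t → 2 ≤ n → 1 ≤ d →
    (F : CommutativeRing 0ℓ 0ℓ) → IsFiniteFieldOfOrder F (q ^ t) →
    (h : Fin d → ℕ) → (∀ i → h i < t) → sumPow q h < q ^ t →
    (W : Fin d → Geometry.Vec F n → Set) →
    (∀ i → Geometry.IsSubspace F (W i)) → (∀ i → Geometry.IsProper F (W i)) →
    (v : Geometry.Vec F n) → ¬ (∀ j → CommutativeRing._≈_ F (v j) (CommutativeRing.0# F)) →
    (∀ i → ¬ W i v) →
    ¬ Geometry.InSpanOfImages F q h W (Geometry.ν F q h v)
mainTheorem1 p e q t n d p-prime _ ≡.refl _ _ _ F isFF h _ _ W W-sub _ v _ v∉W =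
  ν∉span (p ^ e) h (frob-isMonomorphism {e = e} {t} p-prime ≡.refl ∘ h) W W-sub v v∉W
  where open FiniteField F isFF
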